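{- Let $a,b,k_1,k_2$ be nonnegative integers and $c$ a positive integer, and let $L_{k_1,k_2}(a,b,c)$ be as defined in the context. For every negative integer $l$, the coefficient $[z_0^l]L_{k_1,k_2}(a,b,c)$ equals $0$.
   Context: $q$ is an indeterminate; $(y)_m=(1-y)(1-yq)\cdots(1-yq^{m-1})$, $(y)_0=1$. Variables $z_0$, $z^{(1)}=(z^{(1)}_1,\dots,z^{(1)}_{k_1})$, $z^{(2)}=(z^{(2)}_1,\dots,z^{(2)}_{k_2})$. Define \[ L_{k_1,k_2}(a,b,c)=\mathrm{CT}_{z^{(1)}}\frac{\prod_{i=1}^{k_1}(z_0/z_i^{(1)})_a(qz_i^{(1)}/z_0)_b\prod_{1\le i<j\le k_1}(z_i^{(1)}/z_j^{(1)})_c(qz_j^{(1)}/z_i^{(1)})_c}{\prod_{j=1}^{k_2}\prod_{i=1}^{k_1}(z_i^{(1)}/z_j^{(2)})_c}, \] where $\mathrm{CT}_{z^{(1)}}$ is the constant term in $z^{(1)}_1,\dots,z^{(1)}_{k_1}$ and each inverse factor $(1-d\,z_i^{(1)}/z_j^{(2)})^{ -1}$, $d\in\mathbb{Q}(q)$, is expanded as $\sum_{m\ge0}(d\,z_i^{(1)}/z_j^{(2)})^m$; $L_{k_1,k_2}(a,b,c)$ is a Laurent polynomial in $z_0$ whose coefficients are formal series in the $z^{(2)}$ variables. $[z_0^l]F$ denotes the coefficient of $z_0^l$ in $F$. -}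

module Defs where

-- Conventions.
-- q is treated as an additional (nonnegative-degree) variable: every quantity
-- below has coefficients in ℤ[q] ⊂ ℚ(q), so "coefficient = 0 in ℚ(q)" is the
-- same as "every q-coefficient = 0 in ℤ".
-- A monomial q^e · z₀^f · ∏ (z⁽¹⁾ᵢ)^{gᵢ} · ∏ (z⁽²⁾ⱼ)^{hⱼ} is a record Mono.

open import Data.Nat as ℕ using (ℕ; zero; suc; _∸_)
open import Data.Integer as ℤ using (ℤ; +_; -[1+_]; 0ℤ; 1ℤ)
open import Data.Fin as Fin using (Fin)
open import Data.Vec as Vec using (Vec; []; _∷_)
import Data.Vec.Properties as VecP
open import Data.List as List using (List; []; _∷_; _++_; [_])
open import Data.Product using (_×_; _,_; proj₁; proj₂)
open import Data.Bool using (Bool; true; false; if_then_else_; _∧_; T?)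
open import Relation.Nullary.Decidable using (⌊_⌋)

record Mono (k₁ k₂ : ℕ) : Set where
  constructor mono
  field
    qE  : ℤ
    z0E : ℤ
    z1E : Vec ℤ k₁
    z2E : Vec ℤ k₂
open Mono public

module _ {k₁ k₂ : ℕ} where

  _·_ : Mono k₁ k₂ → Mono k₁ k₂ → Mono k₁ k₂
  m · n = mono (qE m ℤ.+ qE n) (z0E m ℤ.+ z0E n)
               (Vec.zipWith ℤ._+_ (z1E m) (z1E n))
               (Vec.zipWith ℤ._+_ (z2E m) (z2E n))

  inv : Mono k₁ k₂ → Mono k₁ k₂
  inv m = mono (ℤ.- qE m) (ℤ.- z0E m) (Vec.map ℤ.-_ (z1E m)) (Vec.map ℤ.-_ (z2E m))

  pow : Mono k₁ k₂ → ℕ → Mono k₁ k₂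
  pow m n = mono (+ n ℤ.* qE m) (+ n ℤ.* z0E m)
                 (Vec.map (+ n ℤ.*_) (z1E m)) (Vec.map (+ n ℤ.*_) (z2E m))

  oneM : Mono k₁ k₂
  oneM = mono 0ℤ 0ℤ (Vec.replicate _ 0ℤ) (Vec.replicate _ 0ℤ)

  unitV : {n : ℕ} → Fin n → Vec ℤ n
  unitV i = Vec.tabulate (λ j → if ⌊ i Fin.≟ j ⌋ then 1ℤ else 0ℤ)

  qM : Mono k₁ k₂
  qM = mono 1ℤ 0ℤ (Vec.replicate _ 0ℤ) (Vec.replicate _ 0ℤ)

  z0M : Mono k₁ k₂
  z0M = mono 0ℤ 1ℤ (Vec.replicate _ 0ℤ) (Vec.replicate _ 0ℤ)

  z1M : Fin k₁ → Mono k₁ k₂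
  z1M i = mono 0ℤ 0ℤ (unitV i) (Vec.replicate _ 0ℤ)

  z2M : Fin k₂ → Mono k₁ k₂
  z2M j = mono 0ℤ 0ℤ (Vec.replicate _ 0ℤ) (unitV j)

  eqM : Mono k₁ k₂ → Mono k₁ k₂ → Bool
  eqM m n = ⌊ qE m ℤ.≟ qE n ⌋ ∧ ⌊ z0E m ℤ.≟ z0E n ⌋
          ∧ ⌊ VecP.≡-dec ℤ._≟_ (z1E m) (z1E n) ⌋ ∧ ⌊ VecP.≡-dec ℤ._≟_ (z2E m) (z2E n) ⌋

  Poly : Set
  Poly = List (ℤ × Mono k₁ k₂)

  monoP : Mono k₁ k₂ → Poly
  monoP m = [ (1ℤ , m) ]

  oneP : Poly
  oneP = monoP oneM

  negP : Poly → Poly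
  negP = List.map (λ t → (ℤ.- proj₁ t , proj₂ t))

  _⊗_ : Poly → Poly → Poly
  P ⊗ Q = List.concatMap (λ s → List.map (λ t → (proj₁ s ℤ.* proj₁ t , proj₂ s · proj₂ t)) Q) P

  prodP : List Poly → Poly
  prodP = List.foldr _⊗_ oneP

  coeffP : Poly → Mono k₁ k₂ → ℤ
  coeffP P μ = List.foldr ℤ._+_ 0ℤ (List.map (λ t → if eqM (proj₂ t) μ then proj₁ t else 0ℤ) P)

  poch : Mono k₁ k₂ → ℕ → Poly
  poch y zero    = oneP
  poch y (suc m) = poch y m ⊗ (oneP ++ negP (monoP (y · pow qM m)))

compositions : ℕ → (r : ℕ) → List (Vec ℕ r)
compositions zero    zero    = [ [] ]
compositions (suc N) zero    = []
compositions N       (suc r) =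
  List.concatMap (λ k → List.map (k ∷_) (compositions (N ∸ k) r)) (List.upTo (suc N))

pairsLt : (k : ℕ) → List (Fin k × Fin k)
pairsLt k = List.concatMap (λ i → List.concatMap
              (λ j → if ⌊ i Fin.<? j ⌋ then [ (i , j) ] else []) (List.allFin k)) (List.allFin k)

module _ (a b c k₁ k₂ : ℕ) where

  numL : Poly {k₁} {k₂}
  numL = prodP (List.map (λ i → poch (z0M · inv (z1M i)) a ⊗ poch (qM · (z1M i · inv z0M)) b)
                         (List.allFin k₁))
       ⊗ prodP (List.map (λ ij → poch (z1M (proj₁ ij) · inv (z1M (proj₂ ij))) c
                                ⊗ poch (qM · (z1M (proj₂ ij) · inv (z1M (proj₁ ij)))) c)
                         (pairsLt k₁))

  -- The denominator ∏ⱼ ∏ᵢ (z⁽¹⁾ᵢ/z⁽²⁾ⱼ)_c = ∏_{i,j} ∏_{t<c} (1 - yᵢⱼₜ),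
  -- yᵢⱼₜ = q^t z⁽¹⁾ᵢ / z⁽²⁾ⱼ; these are the monomials yᵢⱼₜ.
  denFactors : List (Mono k₁ k₂)
  denFactors = List.concatMap (λ i → List.concatMap (λ j → List.map
                 (λ t → pow qM t · (z1M i · inv (z2M j))) (List.upTo c))
                 (List.allFin k₂)) (List.allFin k₁)

  ys : Vec (Mono k₁ k₂) (List.length denFactors)
  ys = Vec.fromList denFactors

  monoOf : Vec ℕ (List.length denFactors) → Mono k₁ k₂
  monoOf m = Vec.foldr _ _·_ oneM (Vec.zipWith pow ys m)

  -- Coefficient of ν in the expansion ∏_f Σ_{m≥0} yf^m: the number of
  -- m : factors → ℕ with ∏ yf^{mf} = ν.  Each yf has total z⁽²⁾-degree −1,
  -- so every such m has Σ mf = −(total z⁽²⁾-degree of ν); we enumerate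
  -- exactly that (finite) set of candidates (none if that degree is > 0).
  geomCoeff : Mono k₁ k₂ → ℤ
  geomCoeff ν with ℤ.- Vec.foldr _ ℤ._+_ 0ℤ (z2E ν)
  ... | + N      = + List.length (List.filter (λ m → T? (eqM (monoOf m) ν)) (compositions N _))
  ... | -[1+ _ ] = 0ℤ

  -- Coefficient of the monomial μ in numL · ∏_f (1 - yf)^{-1} (expanded as above).
  coeffFull : Mono k₁ k₂ → ℤ
  coeffFull μ = List.foldr ℤ._+_ 0ℤ
                  (List.map (λ t → proj₁ t ℤ.* geomCoeff (μ · inv (proj₂ t))) numL)

  -- [q^d z₀^l (z⁽²⁾)^β] L_{k₁,k₂}(a,b,c): since L is the constant term in z⁽¹⁾,
  -- this is the coefficient of q^d z₀^l (z⁽¹⁾)^0 (z⁽²⁾)^β in the full expansion.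
  coeffL : (l : ℤ) → Vec ℤ k₂ → ℕ → ℤ
  coeffL l β d = coeffFull (mono (+ d) l (Vec.replicate k₁ 0ℤ) β)

{-# OPTIONS --safe #-}
module Submission where

open import Defs
open import Data.Nat using (ℕ; _≤_)
open import Data.Integer using (ℤ; _<_; 0ℤ)
open import Data.Vec using (Vec)
open import Relation.Binary.PropositionalEquality using (_≡_)

open import Data.Integer as ℤ using (+_; -[1+_]; +≤+; 1ℤ; _+_; _-_; _*_; -_)
import Data.Integer.Properties as ℤP
open import Algebra.Properties.CommutativeSemigroup ℤP.+-commutativeSemigroup
  using () renaming (interchange to +-interchange)
open import Data.Fin as Fin using (Fin)
open import Data.Vec as Vec using ([]; _∷_)
import Data.Vec.Properties as VecP
open import Data.List as List using (List; []; _∷_)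
open import Data.List.Relation.Unary.All as All using (All; []; _∷_)
import Data.List.Relation.Unary.All.Properties as AllP
open import Data.List.Properties using (filter-none)
open import Data.Product using (_,_; proj₁; proj₂)
open import Data.Bool using (T; T?; if_then_else_)
open import Data.Bool.Properties using (T-∧)
open import Data.Nat using (zero; suc; z≤n)
open import Function using (_∘_; Equivalence)
open import Relation.Nullary using (yes; no; ¬_)
open import Relation.Nullary.Decidable using (⌊_⌋; toWitness)
open import Relation.Binary.PropositionalEquality
  using (refl; cong; cong₂; sym; trans; subst; subst₂; module ≡-Reasoning)

-- Grade monomials by deg = (z₀-degree) + (total z⁽¹⁾-degree).  Every factor
-- (y)_m of the numerator has y of degree 0, so the numerator is homogeneous of
-- degree 0; every y_{ijt} = q^t z⁽¹⁾ᵢ / z⁽²⁾ⱼ of the denominator has degree 1, so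
-- its geometric expansion only contains monomials of degree ≥ 0.  Hence the
-- product has no monomial of negative degree, while q^d z₀^l (z⁽¹⁾)^0 (z⁽²⁾)^β
-- has degree l.

sumℤ : {n : ℕ} → Vec ℤ n → ℤ
sumℤ = Vec.foldr _ _+_ 0ℤ

sumℤ-zipWith-+ : {n : ℕ} (u v : Vec ℤ n) →
  sumℤ (Vec.zipWith _+_ u v) ≡ sumℤ u + sumℤ v
sumℤ-zipWith-+ []      []      = refl
sumℤ-zipWith-+ (x ∷ u) (y ∷ v) =
  trans (cong (_+_ (x + y)) (sumℤ-zipWith-+ u v)) (+-interchange x y (sumℤ u) (sumℤ v))

sumℤ-map-hom : (h : ℤ → ℤ) → h 0ℤ ≡ 0ℤ → (∀ x y → h (x + y) ≡ h x + h y) →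
  {n : ℕ} (u : Vec ℤ n) → sumℤ (Vec.map h u) ≡ h (sumℤ u)
sumℤ-map-hom h h-0 h-+ []      = sym h-0
sumℤ-map-hom h h-0 h-+ (x ∷ u) =
  trans (cong (_+_ (h x)) (sumℤ-map-hom h h-0 h-+ u)) (sym (h-+ x (sumℤ u)))

sumℤ-replicate-0 : (n : ℕ) → sumℤ (Vec.replicate n 0ℤ) ≡ 0ℤ
sumℤ-replicate-0 zero    = refl
sumℤ-replicate-0 (suc n) = cong (_+_ 0ℤ) (sumℤ-replicate-0 n)

sumℤ-tabulate-0 : {n : ℕ} (g : Fin n → ℤ) → (∀ j → g j ≡ 0ℤ) → sumℤ (Vec.tabulate g) ≡ 0ℤ
sumℤ-tabulate-0 {zero}  g g≡0 = refl
sumℤ-tabulate-0 {suc n} g g≡0 =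
  cong₂ _+_ (g≡0 Fin.zero) (sumℤ-tabulate-0 (g ∘ Fin.suc) (g≡0 ∘ Fin.suc))

sumℤ-unitV : {k₁ k₂ n : ℕ} (i : Fin n) → sumℤ (unitV {k₁} {k₂} i) ≡ 1ℤ
sumℤ-unitV {n = suc n} Fin.zero =
  cong (_+_ 1ℤ)
       (sumℤ-tabulate-0 {n} (λ j → if ⌊ Fin.zero Fin.≟ Fin.suc j ⌋ then 1ℤ else 0ℤ) (λ _ → refl))
sumℤ-unitV {k₁} {k₂} {suc n} (Fin.suc i) =
  trans (ℤP.+-identityˡ _)
        (trans (cong sumℤ (VecP.tabulate-cong indicator-suc)) (sumℤ-unitV {k₁} {k₂} i))
  where
  indicator-suc : ∀ (j : Fin n) →
    (if ⌊ Fin.suc i Fin.≟ Fin.suc j ⌋ then 1ℤ else 0ℤ) ≡ (if ⌊ i Fin.≟ j ⌋ then 1ℤ else 0ℤ)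
  indicator-suc j with i Fin.≟ j
  ... | yes _ = refl
  ... | no  _ = refl

module Degree {k₁ k₂ : ℕ} where

  deg : Mono k₁ k₂ → ℤ
  deg m = z0E m + sumℤ (z1E m)

  deg-· : ∀ m n → deg (m · n) ≡ deg m + deg n
  deg-· m n = trans (cong (_+_ (z0E m + z0E n)) (sumℤ-zipWith-+ (z1E m) (z1E n)))
                    (+-interchange (z0E m) (z0E n) (sumℤ (z1E m)) (sumℤ (z1E n)))

  deg-inv : ∀ m → deg (inv m) ≡ - deg m
  deg-inv m = trans (cong (_+_ (- z0E m)) (sumℤ-map-hom -_ refl ℤP.neg-distrib-+ (z1E m)))
                    (sym (ℤP.neg-distrib-+ (z0E m) (sumℤ (z1E m))))

  deg-pow : ∀ m n → deg (pow m n) ≡ + n * deg m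
  deg-pow m n =
    trans (cong (_+_ (+ n * z0E m))
                (sumℤ-map-hom (_*_ (+ n)) (ℤP.*-zeroʳ (+ n)) (ℤP.*-distribˡ-+ (+ n)) (z1E m)))
          (sym (ℤP.*-distribˡ-+ (+ n) (z0E m) (sumℤ (z1E m))))

  deg-oneM : deg oneM ≡ 0ℤ
  deg-oneM = trans (ℤP.+-identityˡ _) (sumℤ-replicate-0 k₁)

  deg-qM : deg qM ≡ 0ℤ
  deg-qM = trans (ℤP.+-identityˡ _) (sumℤ-replicate-0 k₁)

  deg-z0M : deg z0M ≡ 1ℤ
  deg-z0M = cong (_+_ 1ℤ) (sumℤ-replicate-0 k₁)

  deg-z1M : ∀ i → deg (z1M i) ≡ 1ℤ
  deg-z1M i = trans (ℤP.+-identityˡ _) (sumℤ-unitV {k₁} {k₂} i)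

  deg-z2M : ∀ j → deg (z2M j) ≡ 0ℤ
  deg-z2M j = trans (ℤP.+-identityˡ _) (sumℤ-replicate-0 k₁)

  deg-/ : ∀ x y → deg (x · inv y) ≡ deg x - deg y
  deg-/ x y = trans (deg-· x (inv y)) (cong (_+_ (deg x)) (deg-inv y))

  deg-ratio : ∀ x y → deg x ≡ deg y → deg (x · inv y) ≡ 0ℤ
  deg-ratio x y deg-x≡deg-y = begin
    deg (x · inv y)  ≡⟨ deg-/ x y ⟩
    deg x - deg y    ≡⟨ cong (_- deg y) deg-x≡deg-y ⟩
    deg y - deg y    ≡⟨ ℤP.+-inverseʳ (deg y) ⟩
    0ℤ               ∎
    where open ≡-Reasoning

  deg-qᵗ : ∀ t → deg (pow qM t) ≡ 0ℤ
  deg-qᵗ t = trans (deg-pow qM t) (trans (cong (_*_ (+ t)) deg-qM) (ℤP.*-zeroʳ (+ t)))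

  deg-qᵗ· : ∀ t x → deg (pow qM t · x) ≡ deg x
  deg-qᵗ· t x = trans (deg-· (pow qM t) x) (trans (cong (_+ deg x) (deg-qᵗ t)) (ℤP.+-identityˡ (deg x)))

  deg-q· : ∀ x → deg (qM · x) ≡ deg x
  deg-q· x = trans (deg-· qM x) (trans (cong (_+ deg x) deg-qM) (ℤP.+-identityˡ (deg x)))

  eqM-sound : ∀ (m n : Mono k₁ k₂) → T (eqM m n) → m ≡ n
  eqM-sound (mono e f g h) (mono e′ f′ g′ h′) match with Equivalence.to T-∧ match
  ... | e≈ , match′ with Equivalence.to T-∧ match′
  ... | f≈ , match″ with Equivalence.to T-∧ match″
  ... | g≈ , h≈
    with refl ← toWitness {a? = e ℤ.≟ e′} e≈
       | refl ← toWitness {a? = f ℤ.≟ f′} f≈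
       | refl ← toWitness {a? = VecP.≡-dec ℤ._≟_ g g′} g≈
       | refl ← toWitness {a? = VecP.≡-dec ℤ._≟_ h h′} h≈ = refl

  DegreeZero : Poly {k₁} {k₂} → Set
  DegreeZero = All (λ t → deg (proj₂ t) ≡ 0ℤ)

  oneP-degreeZero : DegreeZero oneP
  oneP-degreeZero = deg-oneM ∷ []

  ⊗-degreeZero : ∀ {P Q} → DegreeZero P → DegreeZero Q → DegreeZero (P ⊗ Q)
  ⊗-degreeZero []            _  = []
  ⊗-degreeZero {s ∷ P} (ds ∷ dP) dQ =
    AllP.++⁺ (AllP.map⁺ (All.map (λ {t} dt → trans (deg-· (proj₂ s) (proj₂ t)) (cong₂ _+_ ds dt)) dQ))
             (⊗-degreeZero dP dQ)

  poch-degreeZero : ∀ y → deg y ≡ 0ℤ → ∀ m → DegreeZero (poch y m)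
  poch-degreeZero y deg-y zero    = oneP-degreeZero
  poch-degreeZero y deg-y (suc m) =
    ⊗-degreeZero (poch-degreeZero y deg-y m)
                 (AllP.++⁺ oneP-degreeZero (trans (deg-· y (pow qM m)) (cong₂ _+_ deg-y (deg-qᵗ m)) ∷ []))

  poch-ratio-degreeZero : ∀ x y → deg x ≡ deg y → ∀ m → DegreeZero (poch (x · inv y) m)
  poch-ratio-degreeZero x y deg-x≡deg-y = poch-degreeZero _ (deg-ratio x y deg-x≡deg-y)

  poch-qratio-degreeZero : ∀ x y → deg x ≡ deg y → ∀ m → DegreeZero (poch (qM · (x · inv y)) m)
  poch-qratio-degreeZero x y deg-x≡deg-y =
    poch-degreeZero _ (trans (deg-q· (x · inv y)) (deg-ratio x y deg-x≡deg-y))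

  prodP-degreeZero : {A : Set} (g : A → Poly) → (∀ x → DegreeZero (g x)) →
    ∀ xs → DegreeZero (prodP (List.map g xs))
  prodP-degreeZero g dg []       = oneP-degreeZero
  prodP-degreeZero g dg (x ∷ xs) = ⊗-degreeZero (dg x) (prodP-degreeZero g dg xs)

  deg-pow-nonNeg : ∀ y n → 0ℤ ℤ.≤ deg y → 0ℤ ℤ.≤ deg (pow y n)
  deg-pow-nonNeg y n 0≤y =
    subst₂ ℤ._≤_ (ℤP.*-zeroʳ (+ n)) (sym (deg-pow y n)) (ℤP.*-monoˡ-≤-nonNeg (+ n) 0≤y)

  deg-product-nonNeg : (ys : List (Mono k₁ k₂)) → All (λ y → 0ℤ ℤ.≤ deg y) ys →
    (m : Vec ℕ (List.length ys)) →
    0ℤ ℤ.≤ deg (Vec.foldr _ _·_ oneM (Vec.zipWith pow (Vec.fromList ys) m))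
  deg-product-nonNeg []       []          []      = ℤP.≤-reflexive (sym deg-oneM)
  deg-product-nonNeg (y ∷ ys) (0≤y ∷ 0≤ys) (n ∷ m) =
    subst (0ℤ ℤ.≤_) (sym (deg-· (pow y n) (Vec.foldr _ _·_ oneM (Vec.zipWith pow (Vec.fromList ys) m))))
          (ℤP.+-mono-≤ (deg-pow-nonNeg y n 0≤y) (deg-product-nonNeg ys 0≤ys m))

module _ (a b c k₁ k₂ : ℕ) where

  open Degree {k₁} {k₂}

  numL-degreeZero : DegreeZero (numL a b c k₁ k₂)
  numL-degreeZero = ⊗-degreeZero
    (prodP-degreeZero _ (λ i → ⊗-degreeZero
      (poch-ratio-degreeZero z0M (z1M i) (trans deg-z0M (sym (deg-z1M i))) a)
      (poch-qratio-degreeZero (z1M i) z0M (trans (deg-z1M i) (sym deg-z0M)) b))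
      (List.allFin k₁))
    (prodP-degreeZero _ (λ (i , j) → ⊗-degreeZero
      (poch-ratio-degreeZero (z1M i) (z1M j) (trans (deg-z1M i) (sym (deg-z1M j))) c)
      (poch-qratio-degreeZero (z1M j) (z1M i) (trans (deg-z1M j) (sym (deg-z1M i))) c))
      (pairsLt k₁))

  denFactors-nonNeg : All (λ y → 0ℤ ℤ.≤ deg y) (denFactors a b c k₁ k₂)
  denFactors-nonNeg =
    AllP.concat⁺ (AllP.map⁺ (All.universal (λ i →
      AllP.concat⁺ (AllP.map⁺ (All.universal (λ j →
        AllP.map⁺ (All.universal (λ t → subst (0ℤ ℤ.≤_) (sym (deg-yᵢⱼₜ i j t)) (+≤+ z≤n))
                                 (List.upTo c)))
        (List.allFin k₂))))
      (List.allFin k₁)))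
    where
    deg-yᵢⱼₜ : ∀ i j t → deg (pow qM t · (z1M i · inv (z2M j))) ≡ 1ℤ
    deg-yᵢⱼₜ i j t = begin
      deg (pow qM t · (z1M i · inv (z2M j)))  ≡⟨ deg-qᵗ· t (z1M i · inv (z2M j)) ⟩
      deg (z1M i · inv (z2M j))               ≡⟨ deg-/ (z1M i) (z2M j) ⟩
      deg (z1M i) - deg (z2M j)               ≡⟨ cong₂ _-_ (deg-z1M i) (deg-z2M j) ⟩
      1ℤ                                      ∎
      where open ≡-Reasoning

  geomCoeff-negDeg : ∀ ν → deg ν < 0ℤ → geomCoeff a b c k₁ k₂ ν ≡ 0ℤ
  geomCoeff-negDeg ν ν<0 with - Vec.foldr _ _+_ 0ℤ (z2E ν)
  ... | + N      = cong (λ ms → + List.length ms)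
      (filter-none (λ m → T? (eqM (monoOf a b c k₁ k₂ m) ν))
                   (All.universal no-match (compositions N (List.length (denFactors a b c k₁ k₂)))))
    where
    no-match : ∀ m → ¬ T (eqM (monoOf a b c k₁ k₂ m) ν)
    no-match m match = ℤP.<⇒≱ ν<0
      (subst (0ℤ ℤ.≤_) (cong deg (eqM-sound (monoOf a b c k₁ k₂ m) ν match))
             (deg-product-nonNeg (denFactors a b c k₁ k₂) denFactors-nonNeg m))
  ... | -[1+ _ ] = refl

  coeffFull-negDeg : ∀ μ → deg μ < 0ℤ → coeffFull a b c k₁ k₂ μ ≡ 0ℤ
  coeffFull-negDeg μ μ<0 = terms-vanish (numL a b c k₁ k₂) numL-degreeZero
    where
    deg-quotient : ∀ ν → deg ν ≡ 0ℤ → deg (μ · inv ν) ≡ deg μ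
    deg-quotient ν deg-ν = begin
      deg (μ · inv ν)  ≡⟨ deg-/ μ ν ⟩
      deg μ - deg ν    ≡⟨ cong (_-_ (deg μ)) deg-ν ⟩
      deg μ - 0ℤ       ≡⟨ ℤP.+-identityʳ (deg μ) ⟩
      deg μ            ∎
      where open ≡-Reasoning

    terms-vanish : ∀ P → DegreeZero P →
      List.foldr _+_ 0ℤ (List.map (λ t → proj₁ t * geomCoeff a b c k₁ k₂ (μ · inv (proj₂ t))) P) ≡ 0ℤ
    terms-vanish []            []          = refl
    terms-vanish ((e , ν) ∷ P) (deg-ν ∷ dP) = begin
      e * geomCoeff a b c k₁ k₂ (μ · inv ν) + _
        ≡⟨ cong₂ (λ x y → e * x + y)
                 (geomCoeff-negDeg _ (subst (ℤ._< 0ℤ) (sym (deg-quotient ν deg-ν)) μ<0))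
                 (terms-vanish P dP) ⟩
      e * 0ℤ + 0ℤ
        ≡⟨ cong (_+ 0ℤ) (ℤP.*-zeroʳ e) ⟩
      0ℤ ∎
      where open ≡-Reasoning

lemma4p1 : (a b k₁ k₂ c : ℕ) → 1 ≤ c → (l : ℤ) → l < 0ℤ →
    (β : Vec ℤ k₂) (d : ℕ) → coeffL a b c k₁ k₂ l β d ≡ 0ℤ
lemma4p1 a b k₁ k₂ c _ l l<0 β d =
  coeffFull-negDeg a b c k₁ k₂ μ (subst (ℤ._< 0ℤ) (sym deg-μ) l<0)
  where
  open Degree {k₁} {k₂}

  μ : Mono k₁ k₂
  μ = mono (+ d) l (Vec.replicate k₁ 0ℤ) β

  deg-μ : deg μ ≡ l
  deg-μ = trans (cong (_+_ l) (sumℤ-replicate-0 k₁)) (ℤP.+-identityʳ l)
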